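{- For every ASD $D$, $\sigma(D)\le i(D)\cdot C(D)$ (where the right-hand side is $+\infty$ when $i(D)=\infty$).
   Context: An ASD is a pair $D=(\mathcal{S}_D,\mathcal{P}_D)$ with $\mathcal{S}_D$ a finite set and $\mathcal{P}_D$ a finite nonempty family of set partitions of $\mathcal{S}_D$. For partitions, $\pi\preceq\pi'$ means every block of $\pi$ lies in a block of $\pi'$; $\wedge$ is the meet; $\mathrm{id}_{\mathcal{S}}$ is the partition into singletons. For $\phi:\mathcal{S}\to\mathcal{S}'$ and a partition $\pi$ of $\mathcal{S}'$, $\pi\circ\phi$ is the partition of $\mathcal{S}$ where $x,y$ share a block iff $\phi(x),\phi(y)$ share a block of $\pi$. $D\le D'$ means there exist $\phi:\mathcal{S}_D\to\mathcal{S}_{D'}$, $\alpha:\mathcal{P}_D\to\mathcal{P}_{D'}$ with $\alpha(\pi)\circ\phi\preceq\pi$ for all $\pi$; $D\equiv D'$ means $D\le D'$ and $D'\le D$. $C_m$ is the ASD with state space $\{1,\dots,m\}$ and partition set $\{\mathrm{id}_{\{1,\dots,m\}}\}$. Storage capacity: $C(D)=\max\{\log m: C_m\le D\}$ (log base 2). State complexity: $\sigma(D)=\min_{E\equiv D}\log|\mathcal{S}_E|$. $D$ is perfect if $\mathrm{id}_{\mathcal{S}_D}\in\mathcal{P}_D$; $D^{(k)}$ has state space $\mathcal{S}_D$ and partition set $\{\pi_1\wedge\cdots\wedge\pi_k:\pi_i\in\mathcal{P}_D\}$; the perfectness index $i(D)$ is the least $k\ge1$ with $D^{(k)}$ perfect,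 or $\infty$ if none exists. -}

module Defs where

open import Data.Nat using (ℕ; zero; suc; _≤_; _<_; _^_)
open import Data.Fin using (Fin; toℕ)
open import Data.List using (List; []; _∷_)
open import Data.List.NonEmpty using (List⁺; _∷_; toList; concatMap) renaming (map to map⁺)
open import Data.List.Membership.Propositional using (_∈_)
open import Data.Product using (Σ; ∃; _×_; _,_)
open import Relation.Binary.PropositionalEquality using (_≡_; _≢_)
open import Relation.Nullary using (¬_)

-- Block labels.  A set partition of Fin n is represented by a labelling
-- Fin n → Label; x and y share a block iff their labels are equal.
data Label : Set where
  leaf : ℕ → Label
  node : Label → Label → Label

Partition : ℕ → Set
Partition n = Fin n → Label

SameBlock : ∀ {n} → Partition n → Fin n → Fin n → Set
SameBlock π x y = π x ≡ π y

_⪯_ : ∀ {n} → Partition n → Partition n → Set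
π ⪯ π' = ∀ x y → SameBlock π x y → SameBlock π' x y

_∧ₚ_ : ∀ {n} → Partition n → Partition n → Partition n
(π ∧ₚ π') x = node (π x) (π' x)

topₚ : ∀ {n} → Partition n
topₚ _ = leaf 0

_∘ₚ_ : ∀ {n n'} → Partition n' → (Fin n → Fin n') → Partition n
(π ∘ₚ φ) x = π (φ x)

IsId : ∀ {n} → Partition n → Set
IsId π = ∀ x y → SameBlock π x y → x ≡ y

idₚ : ∀ {n} → Partition n
idₚ x = leaf (toℕ x)

-- An ASD with state space Fin n (a finite set) and a finite nonempty
-- family of partitions (given as a nonempty list; duplicates harmless).
record ASD : Set where
  constructor asd
  field
    n     : ℕ
    parts : List⁺ (Partition n)
open ASD public

_∈ₚ_ : ∀ {n} → Partition n → List⁺ (Partition n) → Set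
π ∈ₚ P = π ∈ toList P

-- D ≤ D'  (α given pointwise: for each π ∈ P_D a chosen α(π) ∈ P_D')
_≤ₐ_ : ASD → ASD → Set
D ≤ₐ D' = Σ (Fin (n D) → Fin (n D')) λ φ →
  ∀ π → π ∈ₚ parts D → Σ (Partition (n D')) λ π' → π' ∈ₚ parts D' × ((π' ∘ₚ φ) ⪯ π)

_≡ₐ_ : ASD → ASD → Set
D ≡ₐ D' = (D ≤ₐ D') × (D' ≤ₐ D)

C : ℕ → ASD
C m = asd m (idₚ ∷ [])

Perfect : ASD → Set
Perfect D = Σ (Partition (n D)) λ π → π ∈ₚ parts D × IsId π

meets : ∀ {n} → ℕ → List⁺ (Partition n) → List⁺ (Partition n)
meets zero    P = P
meets (suc k) P = concatMap (λ π → map⁺ (π ∧ₚ_) (meets k P)) P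

-- D^(k) for k ≥ 1 : D^(suc k) = power D k
power : ASD → ℕ → ASD
power D k = asd (n D) (meets k (parts D))

PerfectPower : ASD → (k : ℕ) → 1 ≤ k → Set
PerfectPower D (suc k) _ = Perfect (power D k)

IsPerfectnessIndex : ASD → ℕ → Set
IsPerfectnessIndex D k =
  Σ (1 ≤ k) λ p → PerfectPower D k p ×
    (∀ j → (q : 1 ≤ j) → j < k → ¬ PerfectPower D j q)

-- C(D) = log M  (M is the maximum m with C_m ≤ D)
IsCapacity : ASD → ℕ → Set
IsCapacity D M = (C M ≤ₐ D) × (∀ m → C m ≤ₐ D → m ≤ M)

module Submission where

-- Proof idea.  Let i(D) = k and C(D) = log M.  It suffices to show
-- |S_D| ≤ M^k, since then E = D itself witnesses σ(D) ≤ k·C(D).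
--
-- Call a map g : S → Fin m a separator of a partition π if g identifies
-- only points in the same block of π, i.e. π has at most m blocks.
--  * Every π ∈ P_D has a separator into Fin M: enumerating the b blocks
--    of π by representatives gives C_b ≤ D, hence b ≤ M by maximality.
--  * Separators of π and π' into Fin m and Fin m' combine into a
--    separator of π ∧ π' into Fin (m·m').
--  * Hence every k-fold meet of partitions of P_D has a separator into
--    Fin (M^k); in particular so does the identity partition in D^(k).
--  * A separator of the identity partition is injective, so |S_D| ≤ M^k.

open import Defs
open import Data.Nat as ℕ using (ℕ; zero; suc; _≤_; _*_; _^_; s≤s; z≤n)
open import Data.Nat.Properties using (≤-reflexive; *-identityʳ)
open import Data.Product using (Σ; _×_; _,_; uncurry)
open import Data.Fin using (Fin; toℕ; combine; inject≤) renaming (zero to fzero; suc to fsuc)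
open import Data.Fin.Properties using (any?; inject≤-injective; combine-injective; injective⇒≤)
open import Data.Empty using (⊥-elim)
open import Data.List as List using (_∷_)
open import Data.List.NonEmpty using (List⁺; _∷_; toList; concatMap) renaming (map to map⁺)
open import Data.List.Membership.Propositional using (_∈_)
open import Data.List.Membership.Propositional.Properties using (∈-map⁻; ∈-concat⁻′)
open import Data.List.Relation.Unary.Any using (here)
open import Relation.Binary.Definitions using (DecidableEquality)
open import Relation.Binary.PropositionalEquality using (_≡_; refl; sym; trans; cong; cong₂)
open import Relation.Nullary using (yes; no)
open import Relation.Nullary.Decidable using (map′; _×-dec_)

leaf-injective : ∀ {a b} → leaf a ≡ leaf b → a ≡ b
leaf-injective refl = refl

node-injective : ∀ {a b c d} → node a b ≡ node c d → a ≡ c × b ≡ d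
node-injective refl = refl , refl

_≟ᴸ_ : DecidableEquality Label
leaf a   ≟ᴸ leaf b   = map′ (cong leaf) leaf-injective (a ℕ.≟ b)
leaf _   ≟ᴸ node _ _ = no λ ()
node _ _ ≟ᴸ leaf _   = no λ ()
node a b ≟ᴸ node c d = map′ (uncurry (cong₂ node)) node-injective ((a ≟ᴸ c) ×-dec (b ≟ᴸ d))

record BlockEnumeration {A : Set} {n : ℕ} (f : Fin n → A) : Set where
  field
    blocks     : ℕ
    rep        : Fin blocks → Fin n
    block      : Fin n → Fin blocks
    rep-apart    : ∀ i j → f (rep i) ≡ f (rep j) → i ≡ j
    rep-in-block : ∀ x → f (rep (block x)) ≡ f x

-- Every map out of a finite set into a type with decidable equality has a
-- block enumeration; by induction on n, the point 0 either joins the fibre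
-- of an existing representative or opens a new block.
enumerate-blocks : ∀ {A : Set} → DecidableEquality A →
  ∀ {n} (f : Fin n → A) → BlockEnumeration f
enumerate-blocks _≟_ {zero} f = record
  { blocks = 0 ; rep = λ () ; block = λ () ; rep-apart = λ () ; rep-in-block = λ () }
enumerate-blocks _≟_ {suc n} f
  with enumerate-blocks _≟_ (λ x → f (fsuc x))
... | record { blocks = b ; rep = r ; block = c ; rep-apart = apart ; rep-in-block = inBlock }
  with any? (λ i → f fzero ≟ f (fsuc (r i)))
... | yes (i , f0≡) = record
  { blocks = b ; rep = λ j → fsuc (r j) ; block = c′
  ; rep-apart = apart ; rep-in-block = inBlock′ }
  where
  c′ : Fin (suc n) → Fin b
  c′ fzero    = i
  c′ (fsuc x) = c x
  inBlock′ : ∀ x → f (fsuc (r (c′ x))) ≡ f x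
  inBlock′ fzero    = sym f0≡
  inBlock′ (fsuc x) = inBlock x
... | no f0-new = record
  { blocks = suc b ; rep = r′ ; block = c′ ; rep-apart = apart′ ; rep-in-block = inBlock′ }
  where
  r′ : Fin (suc b) → Fin (suc n)
  r′ fzero    = fzero
  r′ (fsuc i) = fsuc (r i)
  c′ : Fin (suc n) → Fin (suc b)
  c′ fzero    = fzero
  c′ (fsuc x) = fsuc (c x)
  apart′ : ∀ i j → f (r′ i) ≡ f (r′ j) → i ≡ j
  apart′ fzero    fzero    _ = refl
  apart′ fzero    (fsuc j) e = ⊥-elim (f0-new (j , e))
  apart′ (fsuc i) fzero    e = ⊥-elim (f0-new (i , sym e))
  apart′ (fsuc i) (fsuc j) e = cong fsuc (apart i j e)
  inBlock′ : ∀ x → f (r′ (c′ x)) ≡ f x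
  inBlock′ fzero    = refl
  inBlock′ (fsuc x) = inBlock x

Separator : ∀ {n} → Partition n → ℕ → Set
Separator {n} π m = Σ (Fin n → Fin m) λ g → ∀ x y → g x ≡ g y → SameBlock π x y

separator-weaken : ∀ {n} {π : Partition n} {m m′} → m ≤ m′ → Separator π m → Separator π m′
separator-weaken m≤m′ (g , sep) =
  (λ x → inject≤ (g x) m≤m′) ,
  λ x y e → sep x y (inject≤-injective m≤m′ m≤m′ (g x) (g y) e)

separator-∧ : ∀ {n} {π π′ : Partition n} {m m′} →
  Separator π m → Separator π′ m′ → Separator (π ∧ₚ π′) (m * m′)
separator-∧ (g , sep) (g′ , sep′) =
  (λ x → combine (g x) (g′ x)) ,
  λ x y e → let (e₁ , e₂) = combine-injective (g x) (g′ x) (g y) (g′ y) e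
            in cong₂ node (sep x y e₁) (sep′ x y e₂)

block-separator : ∀ {n} {π : Partition n} (E : BlockEnumeration π) →
  Separator π (BlockEnumeration.blocks E)
block-separator {π = π} E = block , λ x y e →
  trans (sym (rep-in-block x)) (trans (cong (λ i → π (rep i)) e) (rep-in-block y))
  where open BlockEnumeration E

blocks-embed : ∀ (D : ASD) {π} → π ∈ₚ parts D → (E : BlockEnumeration π) →
  C (BlockEnumeration.blocks E) ≤ₐ D
blocks-embed D {π} π∈ E = rep , λ { _ (here refl) →
  π , π∈ , λ i j e → cong (λ k → leaf (toℕ k)) (rep-apart i j e) }
  where open BlockEnumeration E

capacity-separates : ∀ (D : ASD) {M} → IsCapacity D M →
  ∀ π → π ∈ₚ parts D → Separator π M
capacity-separates D (_ , maximal) π π∈ =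
  separator-weaken (maximal _ (blocks-embed D π∈ E)) (block-separator E)
  where E = enumerate-blocks _≟ᴸ_ π

∈-concatMap : ∀ {A B : Set} (f : A → List⁺ B) (P : List⁺ A) {y} →
  y ∈ toList (concatMap f P) → Σ A λ a → a ∈ toList P × y ∈ toList (f a)
∈-concatMap f (p ∷ ps) y∈ with ∈-concat⁻′ (List.map toList (List.map f (p ∷ ps))) y∈
... | _ , y∈xs , xs∈ with ∈-map⁻ toList {xs = List.map f (p ∷ ps)} xs∈
... | _ , q∈ , refl with ∈-map⁻ f {xs = p ∷ ps} q∈
... | a , a∈ , refl = a , a∈ , y∈xs

∈-meets-suc : ∀ {n} {P : List⁺ (Partition n)} j {π} → π ∈ₚ meets (suc j) P →
  Σ (Partition n) λ π₁ → Σ (Partition n) λ π₂ →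
    π₁ ∈ₚ P × π₂ ∈ₚ meets j P × π ≡ π₁ ∧ₚ π₂
∈-meets-suc {P = P} j π∈ with ∈-concatMap _ P π∈
... | π₁ , π₁∈ , π∈′ with ∈-map⁻ (π₁ ∧ₚ_) {xs = toList (meets j P)} π∈′
... | π₂ , π₂∈ , π≡ = π₁ , π₂ , π₁∈ , π₂∈ , π≡

meets-separate : ∀ {n} {P : List⁺ (Partition n)} {m} →
  (∀ π → π ∈ₚ P → Separator π m) →
  ∀ j π → π ∈ₚ meets j P → Separator π (m ^ suc j)
meets-separate {m = m} sepP zero π π∈ =
  separator-weaken (≤-reflexive (sym (*-identityʳ m))) (sepP π π∈)
meets-separate sepP (suc j) π π∈ with ∈-meets-suc j π∈
... | π₁ , π₂ , π₁∈ , π₂∈ , refl =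
  separator-∧ (sepP π₁ π₁∈) (meets-separate sepP j π₂ π₂∈)

identity-separator-bound : ∀ {n} {π : Partition n} {m} → IsId π → Separator π m → n ≤ m
identity-separator-bound isId (g , sep) = injective⇒≤ {f = g} λ {x} {y} e → isId x y (sep x y e)

≤ₐ-refl : ∀ D → D ≤ₐ D
≤ₐ-refl D = (λ x → x) , λ π π∈ → π , π∈ , λ _ _ e → e

proposition5 : (D : ASD) (k M : ℕ) → IsPerfectnessIndex D k → IsCapacity D M →
    Σ ASD (λ E → (E ≡ₐ D) × (n E ≤ M ^ k))
proposition5 D (suc k) M (s≤s z≤n , (π , π∈ , isId) , _) capacity =
  D , (≤ₐ-refl D , ≤ₐ-refl D) , identity-separator-bound isId separator
  where
  separator : Separator π (M ^ suc k)
  separator = meets-separate (capacity-separates D capacity) k π π∈
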